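{- Let $\omega$ be the endomorphism of the ring of symmetric functions (in variables $y_1,y_2,\ldots$, with coefficients in $\mathbb{C}[q]$) defined by $\omega(e_r)=h_r$ for all $r$. Then for every composition $\mu$, $\omega(\overline p_\mu)=\widetilde p_\mu$.
   Context: $e_r$ and $h_r$ are the elementary and complete homogeneous symmetric functions. For $r\ge1$, $\overline p_r=\sum q^{N_=(J)}(q-1)^{N_<(J)}y_{i_1}\cdots y_{i_r}$ and $\widetilde p_r=\sum(-1)^{N_=(J)}(q-1)^{N_<(J)}y_{i_1}\cdots y_{i_r}$, both sums over all weakly increasing sequences $J=(i_1\le i_2\le\cdots\le i_r)$ of positive integers, where $N_=(J)=\#\{j: i_j=i_{j+1}\}$ and $N_<(J)=\#\{j:i_j<i_{j+1}\}$. For a composition $\mu=(\mu_1,\ldots,\mu_s)$, $\overline p_\mu=\overline p_{\mu_1}\cdots\overline p_{\mu_s}$ and $\widetilde p_\mu=\widetilde p_{\mu_1}\cdots\widetilde p_{\mu_s}$. (E.g. $\overline p_3=q^2m_3+q(q-1)m_{21}+(q-1)^2m_{111}$.) -}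

module Defs where

open import Level using (_⊔_)
open import Algebra.Bundles using (CommutativeRing)
open import Data.Bool using (Bool; true; false; if_then_else_; _∧_)
open import Data.Nat as ℕ using (ℕ; zero; suc; _≡ᵇ_; _<ᵇ_; _≤ᵇ_)
open import Data.List using (List; []; _∷_; _++_; [_]; map; foldr; concatMap; filter; length; zipWith; upTo)
open import Data.Nat.ListAction using (sum)
open import Data.Bool.ListAction using (all)
open import Data.List.Properties using (≡-dec)
open import Data.List.Relation.Unary.All using (All)
open import Data.List.Relation.Binary.Permutation.Propositional using (_↭_)
open import Data.Product using (∃)
open import Relation.Nullary using (does)

-- A formal series is given by its coefficient function on monomials; a
-- monomial y^α is an exponent list α = (α₁,…,αₙ) (implicitly padded by zeros).
module SymFun {c ℓ} (R : CommutativeRing c ℓ) where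
  open CommutativeRing R renaming (Carrier to K)

  Mon : Set
  Mon = List ℕ

  Series : Set c
  Series = Mon → K

  _≈S_ : Series → Series → Set ℓ
  f ≈S g = ∀ α → f α ≈ g α

  ΣK : List K → K
  ΣK = foldr _+_ 0#

  pow : K → ℕ → K
  pow x zero    = 1#
  pow x (suc n) = x * pow x n

  below : Mon → List Mon
  below []      = [] ∷ []
  below (a ∷ α) = concatMap (λ k → map (k ∷_) (below α)) (upTo (suc a))

  _⊕_ : Series → Series → Series
  (f ⊕ g) α = f α + g α

  _⊛_ : Series → Series → Series
  (f ⊛ g) α = ΣK (map (λ β → f β * g (zipWith ℕ._∸_ α β)) (below α))

  _·_ : K → Series → Series
  (k · f) α = k * f α

  one : Series
  one α = if all (λ a → a ≡ᵇ 0) α then 1# else 0#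

  record InΛ (f : Series) : Set (c ⊔ ℓ) where
    field
      pad       : ∀ α → f (α ++ [ 0 ]) ≈ f α
      symmetric : ∀ α β → α ↭ β → f α ≈ f β
      bounded   : ∃ λ d → ∀ α → d ℕ.< sum α → f α ≈ 0#

  -- ω is a R-algebra endomorphism of Λ (given as a function on all series,
  -- only its behaviour on Λ is constrained)
  record IsAlgEndo (ω : Series → Series) : Set (c ⊔ ℓ) where
    field
      pres-Λ : ∀ f → InΛ f → InΛ (ω f)
      cong   : ∀ f g → InΛ f → InΛ g → f ≈S g → ω f ≈S ω g
      hom-+  : ∀ f g → InΛ f → InΛ g → ω (f ⊕ g) ≈S (ω f ⊕ ω g)
      hom-*  : ∀ f g → InΛ f → InΛ g → ω (f ⊛ g) ≈S (ω f ⊛ ω g)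
      hom-1  : ω one ≈S one
      hom-·  : ∀ k f → InΛ f → ω (k · f) ≈S (k · ω f)

  e : ℕ → Series
  e r α = if all (λ a → a ≤ᵇ 1) α ∧ (sum α ≡ᵇ r) then 1# else 0#

  h : ℕ → Series
  h r α = if sum α ≡ᵇ r then 1# else 0#

  range : ℕ → ℕ → List ℕ
  range lo n = filter (λ i → lo ℕ.≤? i) (map suc (upTo n))

  wi : ℕ → ℕ → ℕ → List (List ℕ)
  wi zero    lo n = [] ∷ []
  wi (suc r) lo n = concatMap (λ i → map (i ∷_) (wi r i n)) (range lo n)

  -- exponent vector (of length n) of the monomial y_{i₁}⋯y_{i_r}
  content : List ℕ → ℕ → Mon
  content J n = map (λ i → length (filter (λ j → j ℕ.≟ i) J)) (range 1 n)

  N= : List ℕ → ℕ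
  N= (a ∷ b ∷ t) = (if a ≡ᵇ b then 1 else 0) ℕ.+ N= (b ∷ t)
  N= _           = 0

  N< : List ℕ → ℕ
  N< (a ∷ b ∷ t) = (if a <ᵇ b then 1 else 0) ℕ.+ N< (b ∷ t)
  N< _           = 0

  -- coefficient of y^α in Σ_J wt(J) y_{i₁}⋯y_{i_r}, J weakly increasing
  -- (only J with entries ≤ length α can contribute to y^α)
  coeffJ : (List ℕ → K) → ℕ → Series
  coeffJ wt r α =
    ΣK (map (λ J → if does (≡-dec ℕ._≟_ (content J (length α)) α) then wt J else 0#)
            (wi r 1 (length α)))

  pbar₁ : K → ℕ → Series
  pbar₁ q = coeffJ (λ J → pow q (N= J) * pow (q - 1#) (N< J))

  ptilde₁ : K → ℕ → Series
  ptilde₁ q = coeffJ (λ J → pow (- 1#) (N= J) * pow (q - 1#) (N< J))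

  pbar : K → List ℕ → Series
  pbar q μ = foldr (λ r f → pbar₁ q r ⊛ f) one μ

  ptilde : K → List ℕ → Series
  ptilde q μ = foldr (λ r f → ptilde₁ q r ⊛ f) one μ

IsComposition : List ℕ → Set
IsComposition μ = All (λ r → 0 ℕ.< r) μ

-- For r ≥ 1 both power sums expand in the products e_a h_b with a + b = r:
--   p̄_r = Σ_{a+b=r} (-1)^a [b]_q e_a h_b   and   p̃_r = Σ_{a+b=r} (-1)^b [a]_q e_a h_b,
-- where [n]_q = 1 + q + ⋯ + q^(n-1). A weakly increasing
-- sequence is determined by its content α, and if α has ℓ nonzero parts its weight is
-- q^(|α|-ℓ) (q-1)^(ℓ-1), resp. (-1)^(|α|-ℓ) (q-1)^(ℓ-1). On the other side, the coefficient of y^α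
-- in e_a h_b counts the 0/1-vectors β ≤ α with |β| = a, and the weighted count is evaluated one
-- part of α at a time. Since Σ_{a+b=m} (-1)^a e_a h_b = 0 for m ≥ 1, induction gives ω(h_b) = e_b,
-- so ω turns the expansion of p̄_r into that of p̃_r (exchange a and b). Multiplicativity of ω
-- finishes the proof for compositions.

module Submission where

open import Defs
open import Algebra.Bundles using (CommutativeMonoid; CommutativeRing)
open import Data.Bool using (Bool; true; false; if_then_else_; _∧_; T)
open import Data.Bool.ListAction using (all)
import Data.Bool.Properties as Boolₚ
open import Data.List using (List; []; _∷_; _++_; [_]; map; concatMap; filter; length; upTo; applyUpTo; replicate; zipWith)
open import Data.List.Properties as Listₚ using (≡-dec)
open import Data.List.Relation.Binary.Permutation.Propositional as ↭ using (_↭_)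
open import Data.List.Relation.Unary.All as All using (All; []; _∷_)
open import Data.List.Relation.Unary.All.Properties using (map⁺; ++⁺)
open import Data.Nat as ℕ using (ℕ; zero; suc; _∸_; _≤_; _<_; _≡ᵇ_; _≤ᵇ_; _<ᵇ_; _≟_; _≤?_; z≤n; s≤s)
open import Data.Nat.ListAction using (sum)
import Data.Nat.ListAction.Properties as ListActionₚ
import Data.Nat.Properties as ℕₚ
open import Data.Nat.Induction using (<-rec)
open import Data.Product using (_,_; proj₁; proj₂)
open import Function using (_∘_)
import Algebra.Properties.CommutativeSemigroup as CommSemigroupₚ
open import Relation.Binary.PropositionalEquality as ≡ using (_≡_)
open import Relation.Nullary using (does; yes; no; contradiction)
open import Relation.Unary using (Decidable)

n<m⇒m≡ᵇn≡false : ∀ m n → n < m → (m ≡ᵇ n) ≡ false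
n<m⇒m≡ᵇn≡false (suc m) zero    _         = ≡.refl
n<m⇒m≡ᵇn≡false (suc m) (suc n) (s≤s n<m) = n<m⇒m≡ᵇn≡false m n n<m

sum-++-[0] : ∀ α → sum (α ++ [ 0 ]) ≡ sum α
sum-++-[0] α = ≡.trans (ListActionₚ.sum-++ α [ 0 ]) (ℕₚ.+-identityʳ (sum α))

module _ (p : ℕ → Bool) where
  private module ∧-Comm = CommSemigroupₚ (CommutativeMonoid.commutativeSemigroup Boolₚ.∧-commutativeMonoid)

  all-++ : ∀ xs ys → all p (xs ++ ys) ≡ all p xs ∧ all p ys
  all-++ []       ys = ≡.refl
  all-++ (x ∷ xs) ys = ≡.trans (≡.cong (p x ∧_) (all-++ xs ys)) (≡.sym (Boolₚ.∧-assoc (p x) _ _))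

  all-++-[0] : p 0 ≡ true → ∀ α → all p (α ++ [ 0 ]) ≡ all p α
  all-++-[0] p0 α rewrite all-++ α [ 0 ] | p0 = Boolₚ.∧-identityʳ (all p α)

  all-↭ : ∀ {α β} → α ↭ β → all p α ≡ all p β
  all-↭ ↭.refl              = ≡.refl
  all-↭ (↭.prep x α↭β)      = ≡.cong (p x ∧_) (all-↭ α↭β)
  all-↭ (↭.swap x y α↭β)    rewrite all-↭ α↭β = ∧-Comm.x∙yz≈y∙xz (p x) (p y) _
  all-↭ (↭.trans α↭β β↭γ)   = ≡.trans (all-↭ α↭β) (all-↭ β↭γ)

all≡ᵇ0≡sum≡ᵇ0 : ∀ α → all (_≡ᵇ 0) α ≡ (sum α ≡ᵇ 0)
all≡ᵇ0≡sum≡ᵇ0 []          = ≡.refl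
all≡ᵇ0≡sum≡ᵇ0 (zero  ∷ α) = all≡ᵇ0≡sum≡ᵇ0 α
all≡ᵇ0≡sum≡ᵇ0 (suc _ ∷ α) = ≡.refl

all≤ᵇ1∧sum≡ᵇ0≡sum≡ᵇ0 : ∀ α → (all (_≤ᵇ 1) α ∧ (sum α ≡ᵇ 0)) ≡ (sum α ≡ᵇ 0)
all≤ᵇ1∧sum≡ᵇ0≡sum≡ᵇ0 []          = ≡.refl
all≤ᵇ1∧sum≡ᵇ0≡sum≡ᵇ0 (zero  ∷ α) = all≤ᵇ1∧sum≡ᵇ0≡sum≡ᵇ0 α
all≤ᵇ1∧sum≡ᵇ0≡sum≡ᵇ0 (suc x ∷ α) = Boolₚ.∧-zeroʳ _

filter-map-comm : {P Q : ℕ → Set} (P? : Decidable P) (Q? : Decidable Q)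
  (f : ℕ → ℕ) → (∀ x → does (P? (f x)) ≡ does (Q? x)) →
  ∀ xs → filter P? (map f xs) ≡ map f (filter Q? xs)
filter-map-comm P? Q? f eq [] = ≡.refl
filter-map-comm P? Q? f eq (x ∷ xs) with does (P? (f x)) | does (Q? x) | eq x
... | true  | true  | ≡.refl = ≡.cong (f x ∷_) (filter-map-comm P? Q? f eq xs)
... | false | false | ≡.refl = filter-map-comm P? Q? f eq xs

≤ᵇ-suc : ∀ j i → (suc j ≤ᵇ suc i) ≡ (j ≤ᵇ i)
≤ᵇ-suc zero    i = ≡.refl
≤ᵇ-suc (suc j) i = ≡.refl

upTo-suc : ∀ n → upTo (suc n) ≡ 0 ∷ map suc (upTo n)
upTo-suc n = ≡.cong (0 ∷_) (≡.sym (Listₚ.map-applyUpTo (λ k → k) suc n))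

module _ {c ℓ} (R : CommutativeRing c ℓ) where
  open CommutativeRing R renaming (Carrier to K)
  open SymFun R

  -- Weakly increasing sequences and their contents

  range-suc : ∀ j n → range (suc j) n ≡ map suc (filter (j ≤?_) (upTo n))
  range-suc j n = filter-map-comm (suc j ≤?_) (j ≤?_) suc (≤ᵇ-suc j) (upTo n)

  range-1 : ∀ n → range 1 n ≡ map suc (upTo n)
  range-1 n = ≡.trans (range-suc 0 n) (≡.cong (map suc) (filter-0≤ (upTo n)))
    where
    filter-0≤ : ∀ xs → filter (0 ≤?_) xs ≡ xs
    filter-0≤ []       = ≡.refl
    filter-0≤ (x ∷ xs) = ≡.cong (x ∷_) (filter-0≤ xs)

  range-1-suc : ∀ n → range 1 (suc n) ≡ 1 ∷ map suc (map suc (upTo n))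
  range-1-suc n = ≡.trans (range-1 (suc n)) (≡.cong (map suc) (upTo-suc n))

  range-suc-suc : ∀ j n → range (suc (suc j)) (suc n) ≡ map suc (map suc (filter (j ≤?_) (upTo n)))
  range-suc-suc j n = begin
    range (suc (suc j)) (suc n)                           ≡⟨ range-suc (suc j) (suc n) ⟩
    map suc (filter (suc j ≤?_) (upTo (suc n)))            ≡⟨ ≡.cong (map suc ∘ filter (suc j ≤?_)) (upTo-suc n) ⟩
    map suc (filter (suc j ≤?_) (map suc (upTo n)))        ≡⟨ ≡.cong (map suc) (range-suc j n) ⟩
    map suc (map suc (filter (j ≤?_) (upTo n)))            ∎
    where open ≡.≡-Reasoning

  shiftAll : List (List ℕ) → List (List ℕ)
  shiftAll = map (map suc)

  extendBy : ℕ → ℕ → List ℕ → List (List ℕ)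
  extendBy r n = concatMap (λ i → map (i ∷_) (wi r i n))

  extendBy-shift : ∀ r n → (∀ k → wi r (suc (suc k)) (suc n) ≡ shiftAll (wi r (suc k) n)) →
    ∀ ks → extendBy r (suc n) (map suc (map suc ks)) ≡ shiftAll (extendBy r n (map suc ks))
  extendBy-shift r n shift []       = ≡.refl
  extendBy-shift r n shift (k ∷ ks) = begin
    map (suc (suc k) ∷_) (wi r (suc (suc k)) (suc n)) ++ extendBy r (suc n) (map suc (map suc ks))
      ≡⟨ ≡.cong₂ _++_ (≡.cong (map (suc (suc k) ∷_)) (shift k)) (extendBy-shift r n shift ks) ⟩
    map (suc (suc k) ∷_) (shiftAll W) ++ shiftAll (extendBy r n (map suc ks))
      ≡⟨ ≡.cong (_++ _) (≡.trans (≡.sym (Listₚ.map-∘ W)) (Listₚ.map-∘ W)) ⟩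
    shiftAll (map (suc k ∷_) W) ++ shiftAll (extendBy r n (map suc ks))
      ≡⟨ ≡.sym (Listₚ.map-++ (map suc) (map (suc k ∷_) W) _) ⟩
    shiftAll (extendBy r n (map suc (k ∷ ks)))  ∎
    where
    open ≡.≡-Reasoning
    W = wi r (suc k) n

  wi-shift : ∀ r j n → wi r (suc (suc j)) (suc n) ≡ shiftAll (wi r (suc j) n)
  wi-shift zero    j n = ≡.refl
  wi-shift (suc r) j n = begin
    extendBy r (suc n) (range (suc (suc j)) (suc n))
      ≡⟨ ≡.cong (extendBy r (suc n)) (range-suc-suc j n) ⟩
    extendBy r (suc n) (map suc (map suc (filter (j ≤?_) (upTo n))))
      ≡⟨ extendBy-shift r n (λ k → wi-shift r k n) (filter (j ≤?_) (upTo n)) ⟩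
    shiftAll (extendBy r n (map suc (filter (j ≤?_) (upTo n))))
      ≡⟨ ≡.cong (shiftAll ∘ extendBy r n) (range-suc j n) ⟨
    shiftAll (extendBy r n (range (suc j) n)) ∎
    where open ≡.≡-Reasoning

  wi-1-suc : ∀ r n → wi (suc r) 1 (suc n) ≡ map (1 ∷_) (wi r 1 (suc n)) ++ shiftAll (wi (suc r) 1 n)
  wi-1-suc r n = begin
    extendBy r (suc n) (range 1 (suc n))                               ≡⟨ ≡.cong (extendBy r (suc n)) (range-1-suc n) ⟩
    map (1 ∷_) (wi r 1 (suc n)) ++ extendBy r (suc n) (map suc (map suc (upTo n)))
      ≡⟨ ≡.cong (map (1 ∷_) (wi r 1 (suc n)) ++_) (extendBy-shift r n (λ k → wi-shift r k n) (upTo n)) ⟩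
    map (1 ∷_) (wi r 1 (suc n)) ++ shiftAll (extendBy r n (map suc (upTo n)))
      ≡⟨ ≡.cong (λ is → map (1 ∷_) (wi r 1 (suc n)) ++ shiftAll (extendBy r n is)) (range-1 n) ⟨
    map (1 ∷_) (wi r 1 (suc n)) ++ shiftAll (wi (suc r) 1 n)          ∎
    where open ≡.≡-Reasoning

  Positive : List ℕ → Set
  Positive = All (0 <_)

  map-suc-positive : ∀ J → Positive (map suc J)
  map-suc-positive J = map⁺ (All.universal (λ _ → s≤s z≤n) J)

  wi-positive : ∀ r n → All Positive (wi r 1 n)
  wi-positive zero    n       = [] ∷ []
  wi-positive (suc r) zero    = []
  wi-positive (suc r) (suc n) rewrite wi-1-suc r n =
    ++⁺ (map⁺ (All.map (s≤s z≤n ∷_) (wi-positive r (suc n))))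
        (map⁺ (All.universal map-suc-positive (wi (suc r) 1 n)))

  count : ℕ → List ℕ → ℕ
  count i J = length (filter (_≟ i) J)

  count-map-suc : ∀ i J → count (suc i) (map suc J) ≡ count i J
  count-map-suc i J = ≡.trans (≡.cong length (filter-map-comm (_≟ suc i) (_≟ i) suc (λ _ → ≡.refl) J))
                              (Listₚ.length-map suc (filter (_≟ i) J))

  count-0-positive : ∀ J → Positive J → count 0 J ≡ 0
  count-0-positive []          []       = ≡.refl
  count-0-positive (suc _ ∷ J) (_ ∷ ps) = count-0-positive J ps

  content≡counts : ∀ J n → content J n ≡ map (λ k → count (suc k) J) (upTo n)
  content≡counts J n = ≡.trans (≡.cong (map (λ i → count i J)) (range-1 n)) (≡.sym (Listₚ.map-∘ (upTo n)))

  content-suc : ∀ J n → content J (suc n) ≡ count 1 J ∷ map (λ k → count (suc (suc k)) J) (upTo n)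
  content-suc J n = ≡.trans (≡.cong (map (λ i → count i J)) (range-1-suc n))
    (≡.cong (count 1 J ∷_) (≡.trans (≡.sym (Listₚ.map-∘ (map suc (upTo n)))) (≡.sym (Listₚ.map-∘ (upTo n)))))

  content-map-suc : ∀ J n → Positive J → content (map suc J) (suc n) ≡ 0 ∷ content J n
  content-map-suc J n pos = ≡.trans (content-suc (map suc J) n)
    (≡.cong₂ _∷_ (≡.trans (count-map-suc 0 J) (count-0-positive J pos))
                 (≡.trans (Listₚ.map-cong (λ k → count-map-suc (suc k) J) (upTo n)) (≡.sym (content≡counts J n))))

  -- Finite sums

  open import Relation.Binary.Reasoning.Setoid setoid
  open import Algebra.Solver.Ring.NaturalCoefficients.Default commutativeSemiring using (solve; _:=_; _:+_; _:*_)

  private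
    module +-Comm = CommSemigroupₚ +-commutativeSemigroup
    module *-Comm = CommSemigroupₚ *-commutativeSemigroup

  ≡⇒≈ : ∀ {x y} → x ≡ y → x ≈ y
  ≡⇒≈ ≡.refl = refl

  guard : Bool → K → K
  guard b x = if b then x else 0#

  guard-cong : ∀ b {x y} → x ≈ y → guard b x ≈ guard b y
  guard-cong true  x≈y = x≈y
  guard-cong false _   = refl

  guard-0 : ∀ b → guard b 0# ≈ 0#
  guard-0 true  = refl
  guard-0 false = refl

  guard-+ : ∀ b x y → guard b (x + y) ≈ guard b x + guard b y
  guard-+ true  x y = refl
  guard-+ false x y = sym (+-identityˡ 0#)

  pow-homo-+ : ∀ x m n → pow x (m ℕ.+ n) ≈ pow x m * pow x n
  pow-homo-+ x zero    n = sym (*-identityˡ _)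
  pow-homo-+ x (suc m) n = trans (*-cong refl (pow-homo-+ x m n)) (sym (*-assoc _ _ _))

  module _ {a} {A : Set a} where

    ΣK-map-cong : ∀ {f g : A → K} xs → (∀ x → f x ≈ g x) → ΣK (map f xs) ≈ ΣK (map g xs)
    ΣK-map-cong []       f≈g = refl
    ΣK-map-cong (x ∷ xs) f≈g = +-cong (f≈g x) (ΣK-map-cong xs f≈g)

    ΣK-map-cong-All : ∀ {p} {P : A → Set p} {f g : A → K} {xs} → All P xs →
      (∀ x → P x → f x ≈ g x) → ΣK (map f xs) ≈ ΣK (map g xs)
    ΣK-map-cong-All []         f≈g = refl
    ΣK-map-cong-All (px ∷ pxs) f≈g = +-cong (f≈g _ px) (ΣK-map-cong-All pxs f≈g)

    ΣK-map-0 : ∀ {f : A → K} xs → (∀ x → f x ≈ 0#) → ΣK (map f xs) ≈ 0#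
    ΣK-map-0 []       f≈0 = refl
    ΣK-map-0 (x ∷ xs) f≈0 = trans (+-cong (f≈0 x) (ΣK-map-0 xs f≈0)) (+-identityˡ 0#)

    ΣK-map-+ : ∀ (f g : A → K) xs → ΣK (map (λ x → f x + g x) xs) ≈ ΣK (map f xs) + ΣK (map g xs)
    ΣK-map-+ f g []       = sym (+-identityˡ 0#)
    ΣK-map-+ f g (x ∷ xs) = trans (+-cong refl (ΣK-map-+ f g xs)) (+-Comm.interchange (f x) (g x) _ _)

    *-distribˡ-ΣK-map : ∀ k (f : A → K) xs → k * ΣK (map f xs) ≈ ΣK (map (λ x → k * f x) xs)
    *-distribˡ-ΣK-map k f []       = zeroʳ k
    *-distribˡ-ΣK-map k f (x ∷ xs) = trans (distribˡ k (f x) _) (+-cong refl (*-distribˡ-ΣK-map k f xs))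

    ΣK-map-++ : ∀ (f : A → K) xs ys → ΣK (map f (xs ++ ys)) ≈ ΣK (map f xs) + ΣK (map f ys)
    ΣK-map-++ f []       ys = sym (+-identityˡ _)
    ΣK-map-++ f (x ∷ xs) ys = trans (+-cong refl (ΣK-map-++ f xs ys)) (sym (+-assoc _ _ _))

    ΣK-map-guard : ∀ b (f : A → K) xs → ΣK (map (λ x → guard b (f x)) xs) ≈ guard b (ΣK (map f xs))
    ΣK-map-guard true  f xs = refl
    ΣK-map-guard false f xs = ΣK-map-0 xs (λ _ → refl)

    ΣK-map-∘ : ∀ {b} {B : Set b} (f : B → K) (g : A → B) xs → ΣK (map f (map g xs)) ≡ ΣK (map (f ∘ g) xs)
    ΣK-map-∘ f g xs = ≡.cong ΣK (≡.sym (Listₚ.map-∘ xs))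

  ΣK-map-concatMap : ∀ {a b} {A : Set a} {B : Set b} (f : B → K) (g : A → List B) xs →
    ΣK (map f (concatMap g xs)) ≈ ΣK (map (λ x → ΣK (map f (g x))) xs)
  ΣK-map-concatMap f g []       = refl
  ΣK-map-concatMap f g (x ∷ xs) = trans (ΣK-map-++ f (g x) (concatMap g xs)) (+-cong refl (ΣK-map-concatMap f g xs))

  sumBelow : ℕ → (ℕ → K) → K
  sumBelow zero    F = 0#
  sumBelow (suc n) F = F 0 + sumBelow n (F ∘ suc)

  ΣK-map-applyUpTo : ∀ (F : ℕ → K) (g : ℕ → ℕ) n → ΣK (map F (applyUpTo g n)) ≡ sumBelow n (F ∘ g)
  ΣK-map-applyUpTo F g zero    = ≡.refl
  ΣK-map-applyUpTo F g (suc n) = ≡.cong (F (g 0) +_) (ΣK-map-applyUpTo F (g ∘ suc) n)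

  sumBelow-cong : ∀ n {F G : ℕ → K} → (∀ k → k < n → F k ≈ G k) → sumBelow n F ≈ sumBelow n G
  sumBelow-cong zero    F≈G = refl
  sumBelow-cong (suc n) F≈G = +-cong (F≈G 0 (s≤s z≤n)) (sumBelow-cong n (λ k k<n → F≈G (suc k) (s≤s k<n)))

  sumBelow-0 : ∀ n {F : ℕ → K} → (∀ k → F k ≈ 0#) → sumBelow n F ≈ 0#
  sumBelow-0 zero    F≈0 = refl
  sumBelow-0 (suc n) F≈0 = trans (+-cong (F≈0 0) (sumBelow-0 n (F≈0 ∘ suc))) (+-identityˡ 0#)

  sumBelow-+ : ∀ n (F G : ℕ → K) → sumBelow n (λ k → F k + G k) ≈ sumBelow n F + sumBelow n G
  sumBelow-+ zero    F G = sym (+-identityˡ 0#)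
  sumBelow-+ (suc n) F G = trans (+-cong refl (sumBelow-+ n (F ∘ suc) (G ∘ suc))) (+-Comm.interchange (F 0) (G 0) _ _)

  sumBelow-last : ∀ n (F : ℕ → K) → sumBelow (suc n) F ≈ sumBelow n F + F n
  sumBelow-last zero    F = +-comm (F 0) 0#
  sumBelow-last (suc n) F = trans (+-cong refl (sumBelow-last n (F ∘ suc))) (sym (+-assoc _ _ _))

  sumBelow-swap : ∀ n m (F : ℕ → ℕ → K) →
    sumBelow n (λ i → sumBelow m (F i)) ≈ sumBelow m (λ j → sumBelow n (λ i → F i j))
  sumBelow-swap zero    m F = sym (sumBelow-0 m (λ _ → refl))
  sumBelow-swap (suc n) m F = begin
    sumBelow m (F 0) + sumBelow n (λ i → sumBelow m (F (suc i)))    ≈⟨ +-cong refl (sumBelow-swap n m (F ∘ suc)) ⟩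
    sumBelow m (F 0) + sumBelow m (λ j → sumBelow n (λ i → F (suc i) j)) ≈⟨ sumBelow-+ m (F 0) _ ⟨
    sumBelow m (λ j → F 0 j + sumBelow n (λ i → F (suc i) j))          ∎

  sumBelow-reverse : ∀ x (F : ℕ → K) → sumBelow (suc x) F ≈ sumBelow (suc x) (λ k → F (x ∸ k))
  sumBelow-reverse zero    F = refl
  sumBelow-reverse (suc x) F = begin
    F 0 + sumBelow (suc x) (F ∘ suc)
      ≈⟨ +-comm _ _ ⟩
    sumBelow (suc x) (F ∘ suc) + F 0
      ≈⟨ +-cong (sumBelow-reverse x (F ∘ suc)) refl ⟩
    sumBelow (suc x) (λ k → F (suc (x ∸ k))) + F 0
      ≈⟨ +-cong (sumBelow-cong (suc x) λ k k<1+x → ≡⇒≈ (≡.cong F (ℕₚ.+-∸-assoc 1 (ℕₚ.≤-pred k<1+x))))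
                (≡⇒≈ (≡.cong F (ℕₚ.n∸n≡0 x))) ⟨
    sumBelow (suc x) (λ k → F (suc x ∸ k)) + F (suc x ∸ suc x)
      ≈⟨ sumBelow-last (suc x) (λ k → F (suc x ∸ k)) ⟨
    sumBelow (suc (suc x)) (λ k → F (suc x ∸ k)) ∎

  antidiagonalSum : ℕ → (ℕ → ℕ → K) → K
  antidiagonalSum zero    F = F 0 0
  antidiagonalSum (suc m) F = F 0 (suc m) + antidiagonalSum m (λ a b → F (suc a) b)

  antidiagonalSum-cong : ∀ m {F G : ℕ → ℕ → K} → (∀ a b → b ≤ m → F a b ≈ G a b) →
    antidiagonalSum m F ≈ antidiagonalSum m G
  antidiagonalSum-cong zero    F≈G = F≈G 0 0 z≤n
  antidiagonalSum-cong (suc m) F≈G =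
    +-cong (F≈G 0 (suc m) ℕₚ.≤-refl) (antidiagonalSum-cong m (λ a b b≤m → F≈G (suc a) b (ℕₚ.m≤n⇒m≤1+n b≤m)))

  antidiagonalSum-0 : ∀ m {F : ℕ → ℕ → K} → (∀ a b → F a b ≈ 0#) → antidiagonalSum m F ≈ 0#
  antidiagonalSum-0 zero    F≈0 = F≈0 0 0
  antidiagonalSum-0 (suc m) F≈0 = trans (+-cong (F≈0 0 (suc m)) (antidiagonalSum-0 m (λ a → F≈0 (suc a)))) (+-identityˡ 0#)

  antidiagonalSum-last : ∀ m (F : ℕ → ℕ → K) →
    antidiagonalSum (suc m) F ≈ antidiagonalSum m (λ a b → F a (suc b)) + F (suc m) 0
  antidiagonalSum-last zero    F = refl
  antidiagonalSum-last (suc m) F = trans (+-cong refl (antidiagonalSum-last m (λ a b → F (suc a) b))) (sym (+-assoc _ _ _))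

  antidiagonalSum-swap : ∀ m (F : ℕ → ℕ → K) → antidiagonalSum m F ≈ antidiagonalSum m (λ a b → F b a)
  antidiagonalSum-swap zero    F = refl
  antidiagonalSum-swap (suc m) F = begin
    F 0 (suc m) + antidiagonalSum m (λ a b → F (suc a) b) ≈⟨ +-cong refl (antidiagonalSum-swap m (λ a b → F (suc a) b)) ⟩
    F 0 (suc m) + antidiagonalSum m (λ a b → F (suc b) a) ≈⟨ +-comm _ _ ⟩
    antidiagonalSum m (λ a b → F (suc b) a) + F 0 (suc m) ≈⟨ antidiagonalSum-last m (λ a b → F b a) ⟨
    antidiagonalSum (suc m) (λ a b → F b a)               ∎

  antidiagonalSum-ΣK-map : ∀ {a} {A : Set a} m (F : ℕ → ℕ → A → K) xs →
    antidiagonalSum m (λ a b → ΣK (map (F a b) xs)) ≈ ΣK (map (λ x → antidiagonalSum m (λ a b → F a b x)) xs)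
  antidiagonalSum-ΣK-map zero    F xs = refl
  antidiagonalSum-ΣK-map (suc m) F xs =
    trans (+-cong refl (antidiagonalSum-ΣK-map m (λ a b → F (suc a) b) xs)) (sym (ΣK-map-+ _ _ xs))

  -- Products of series and the ring Λ

  convolution : Mon → (Mon → Mon → K) → K
  convolution α F = ΣK (map (λ β → F β (zipWith _∸_ α β)) (below α))

  convolution-[] : ∀ F → convolution [] F ≈ F [] []
  convolution-[] F = +-identityʳ _

  convolution-∷ : ∀ x α F →
    convolution (x ∷ α) F ≈ sumBelow (suc x) (λ k → convolution α (λ β γ → F (k ∷ β) ((x ∸ k) ∷ γ)))
  convolution-∷ x α F = begin
    ΣK (map Fα (concatMap (λ k → map (k ∷_) (below α)) (upTo (suc x))))
      ≈⟨ ΣK-map-concatMap Fα (λ k → map (k ∷_) (below α)) (upTo (suc x)) ⟩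
    ΣK (map (λ k → ΣK (map Fα (map (k ∷_) (below α)))) (upTo (suc x)))
      ≈⟨ ΣK-map-cong (upTo (suc x)) (λ k → ≡⇒≈ (ΣK-map-∘ Fα (k ∷_) (below α))) ⟩
    ΣK (map (λ k → convolution α (λ β γ → F (k ∷ β) ((x ∸ k) ∷ γ))) (upTo (suc x)))
      ≡⟨ ΣK-map-applyUpTo _ (λ k → k) (suc x) ⟩
    sumBelow (suc x) (λ k → convolution α (λ β γ → F (k ∷ β) ((x ∸ k) ∷ γ))) ∎
    where Fα = λ β → F β (zipWith _∸_ (x ∷ α) β)

  convolution-cong : ∀ α {F G} → (∀ β γ → sum β ℕ.+ sum γ ≡ sum α → F β γ ≈ G β γ) →
    convolution α F ≈ convolution α G
  convolution-cong []      F≈G = +-cong (F≈G [] [] ≡.refl) refl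
  convolution-cong (x ∷ α) {F} {G} F≈G = begin
    convolution (x ∷ α) F                                                      ≈⟨ convolution-∷ x α F ⟩
    sumBelow (suc x) (λ k → convolution α (λ β γ → F (k ∷ β) ((x ∸ k) ∷ γ)))  ≈⟨ sumBelow-cong (suc x) (λ k k<1+x →
      convolution-cong α λ β γ sum≡ → F≈G (k ∷ β) ((x ∸ k) ∷ γ) (sum-∷ k β γ (ℕₚ.≤-pred k<1+x) sum≡)) ⟩
    sumBelow (suc x) (λ k → convolution α (λ β γ → G (k ∷ β) ((x ∸ k) ∷ γ)))  ≈⟨ convolution-∷ x α G ⟨
    convolution (x ∷ α) G                                                      ∎
    where
    sum-∷ : ∀ k β γ → k ≤ x → sum β ℕ.+ sum γ ≡ sum α → sum (k ∷ β) ℕ.+ sum ((x ∸ k) ∷ γ) ≡ sum (x ∷ α)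
    sum-∷ k β γ k≤x sum≡ = ≡.trans (CommSemigroupₚ.interchange ℕₚ.+-commutativeSemigroup k (sum β) (x ∸ k) (sum γ))
                                   (≡.cong₂ ℕ._+_ (ℕₚ.m+[n∸m]≡n k≤x) sum≡)

  ≈S-sym : ∀ {f g} → f ≈S g → g ≈S f
  ≈S-sym f≈g α = sym (f≈g α)

  ≈S-trans : ∀ {f g k} → f ≈S g → g ≈S k → f ≈S k
  ≈S-trans f≈g g≈k α = trans (f≈g α) (g≈k α)

  slice : ℕ → Series → Series
  slice k f β = f (k ∷ β)

  ⊛-∷ : ∀ x α f g → (f ⊛ g) (x ∷ α) ≈ sumBelow (suc x) (λ k → (slice k f ⊛ slice (x ∸ k) g) α)
  ⊛-∷ x α f g = convolution-∷ x α (λ β γ → f β * g γ)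

  ⊛-[] : ∀ f g → (f ⊛ g) [] ≈ f [] * g []
  ⊛-[] f g = convolution-[] (λ β γ → f β * g γ)

  ⊛-cong : ∀ {f f′ g g′} → f ≈S f′ → g ≈S g′ → (f ⊛ g) ≈S (f′ ⊛ g′)
  ⊛-cong f≈f′ g≈g′ α = ΣK-map-cong (below α) (λ β → *-cong (f≈f′ β) (g≈g′ _))

  ⊛-zeroˡ : ∀ f g → (∀ β → f β ≈ 0#) → ∀ α → (f ⊛ g) α ≈ 0#
  ⊛-zeroˡ f g f≈0 α = ΣK-map-0 (below α) (λ β → trans (*-cong (f≈0 β) refl) (zeroˡ _))

  ⊛-comm : ∀ f g α → (f ⊛ g) α ≈ (g ⊛ f) α
  ⊛-comm f g []      = +-cong (*-comm _ _) refl
  ⊛-comm f g (x ∷ α) = begin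
    (f ⊛ g) (x ∷ α)
      ≈⟨ ⊛-∷ x α f g ⟩
    sumBelow (suc x) (λ k → (slice k f ⊛ slice (x ∸ k) g) α)
      ≈⟨ sumBelow-cong (suc x) (λ k _ → ⊛-comm (slice k f) (slice (x ∸ k) g) α) ⟩
    sumBelow (suc x) (λ k → (slice (x ∸ k) g ⊛ slice k f) α)
      ≈⟨ sumBelow-reverse x (λ k → (slice (x ∸ k) g ⊛ slice k f) α) ⟩
    sumBelow (suc x) (λ k → (slice (x ∸ (x ∸ k)) g ⊛ slice (x ∸ k) f) α)
      ≈⟨ sumBelow-cong (suc x) (λ k k<1+x →
           ≡⇒≈ (≡.cong (λ j → (slice j g ⊛ slice (x ∸ k) f) α) (ℕₚ.m∸[m∸n]≡n (ℕₚ.≤-pred k<1+x)))) ⟩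
    sumBelow (suc x) (λ k → (slice k g ⊛ slice (x ∸ k) f) α)
      ≈⟨ ⊛-∷ x α g f ⟨
    (g ⊛ f) (x ∷ α) ∎

  one-⊛ : ∀ g α → (one ⊛ g) α ≈ g α
  one-⊛ g []      = trans (+-identityʳ _) (*-identityˡ _)
  one-⊛ g (x ∷ α) = begin
    (one ⊛ g) (x ∷ α)                                                                ≈⟨ ⊛-∷ x α one g ⟩
    (one ⊛ slice x g) α + sumBelow x (λ k → (slice (suc k) one ⊛ slice (x ∸ suc k) g) α)
      ≈⟨ +-cong (one-⊛ (slice x g) α)
                (sumBelow-0 x (λ k → ⊛-zeroˡ (slice (suc k) one) (slice (x ∸ suc k) g) (λ _ → refl) α)) ⟩
    g (x ∷ α) + 0#                                                                   ≈⟨ +-identityʳ _ ⟩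
    g (x ∷ α)                                                                        ∎

  Padded : Series → Set ℓ
  Padded f = ∀ α → f (α ++ [ 0 ]) ≈ f α

  Symmetric : Series → Set ℓ
  Symmetric f = ∀ α β → α ↭ β → f α ≈ f β

  Bounded : ℕ → Series → Set ℓ
  Bounded d f = ∀ α → d ℕ.< sum α → f α ≈ 0#

  ⊛-padded : ∀ f g → Padded f → Padded g → Padded (f ⊛ g)
  ⊛-padded f g pad-f pad-g [] = begin
    (f ⊛ g) [ 0 ]                   ≈⟨ ⊛-∷ 0 [] f g ⟩
    (slice 0 f ⊛ slice 0 g) [] + 0# ≈⟨ +-identityʳ _ ⟩
    (slice 0 f ⊛ slice 0 g) []      ≈⟨ ⊛-[] (slice 0 f) (slice 0 g) ⟩
    f [ 0 ] * g [ 0 ]               ≈⟨ *-cong (pad-f []) (pad-g []) ⟩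
    f [] * g []                     ≈⟨ ⊛-[] f g ⟨
    (f ⊛ g) []                      ∎
  ⊛-padded f g pad-f pad-g (x ∷ α) = begin
    (f ⊛ g) (x ∷ α ++ [ 0 ])                                          ≈⟨ ⊛-∷ x (α ++ [ 0 ]) f g ⟩
    sumBelow (suc x) (λ k → (slice k f ⊛ slice (x ∸ k) g) (α ++ [ 0 ])) ≈⟨ sumBelow-cong (suc x) (λ k _ →
      ⊛-padded (slice k f) (slice (x ∸ k) g) (pad-f ∘ (k ∷_)) (pad-g ∘ ((x ∸ k) ∷_)) α) ⟩
    sumBelow (suc x) (λ k → (slice k f ⊛ slice (x ∸ k) g) α)          ≈⟨ ⊛-∷ x α f g ⟨
    (f ⊛ g) (x ∷ α)                                                   ∎

  slice-symmetric : ∀ k {f} → Symmetric f → Symmetric (slice k f)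
  slice-symmetric k sym-f α β α↭β = sym-f (k ∷ α) (k ∷ β) (↭.prep k α↭β)

  slice-slice : ∀ k l {f} → Symmetric f → slice l (slice k f) ≈S slice k (slice l f)
  slice-slice k l sym-f β = sym-f (k ∷ l ∷ β) (l ∷ k ∷ β) (↭.swap k l ↭.refl)

  ⊛-∷-∷ : ∀ x y α f g → (f ⊛ g) (x ∷ y ∷ α) ≈
    sumBelow (suc x) (λ k → sumBelow (suc y) (λ l → (slice l (slice k f) ⊛ slice (y ∸ l) (slice (x ∸ k) g)) α))
  ⊛-∷-∷ x y α f g = trans (⊛-∷ x (y ∷ α) f g) (sumBelow-cong (suc x) (λ k _ → ⊛-∷ y α (slice k f) (slice (x ∸ k) g)))

  ⊛-symmetric : ∀ f g → Symmetric f → Symmetric g → Symmetric (f ⊛ g)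
  ⊛-symmetric f g sym-f sym-g _ _ ↭.refl = refl
  ⊛-symmetric f g sym-f sym-g _ _ (↭.trans α↭β β↭γ) =
    trans (⊛-symmetric f g sym-f sym-g _ _ α↭β) (⊛-symmetric f g sym-f sym-g _ _ β↭γ)
  ⊛-symmetric f g sym-f sym-g _ _ (↭.prep {xs = α} {ys = β} x α↭β) = begin
    (f ⊛ g) (x ∷ α)                                           ≈⟨ ⊛-∷ x α f g ⟩
    sumBelow (suc x) (λ k → (slice k f ⊛ slice (x ∸ k) g) α)  ≈⟨ sumBelow-cong (suc x) (λ k _ →
      ⊛-symmetric _ _ (slice-symmetric k sym-f) (slice-symmetric (x ∸ k) sym-g) α β α↭β) ⟩
    sumBelow (suc x) (λ k → (slice k f ⊛ slice (x ∸ k) g) β)  ≈⟨ ⊛-∷ x β f g ⟨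
    (f ⊛ g) (x ∷ β)                                           ∎
  ⊛-symmetric f g sym-f sym-g _ _ (↭.swap {xs = α} {ys = β} x y α↭β) = begin
    (f ⊛ g) (x ∷ y ∷ α)
      ≈⟨ ⊛-∷-∷ x y α f g ⟩
    sumBelow (suc x) (λ k → sumBelow (suc y) (λ l → (slice l (slice k f) ⊛ slice (y ∸ l) (slice (x ∸ k) g)) α))
      ≈⟨ sumBelow-cong (suc x) (λ k _ → sumBelow-cong (suc y) (λ l _ → ⊛-symmetric _ _
           (slice-symmetric l (slice-symmetric k sym-f)) (slice-symmetric (y ∸ l) (slice-symmetric (x ∸ k) sym-g)) α β α↭β)) ⟩
    sumBelow (suc x) (λ k → sumBelow (suc y) (λ l → (slice l (slice k f) ⊛ slice (y ∸ l) (slice (x ∸ k) g)) β))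
      ≈⟨ sumBelow-swap (suc x) (suc y) (λ k l → (slice l (slice k f) ⊛ slice (y ∸ l) (slice (x ∸ k) g)) β) ⟩
    sumBelow (suc y) (λ l → sumBelow (suc x) (λ k → (slice l (slice k f) ⊛ slice (y ∸ l) (slice (x ∸ k) g)) β))
      ≈⟨ sumBelow-cong (suc y) (λ l _ → sumBelow-cong (suc x) (λ k _ →
           ⊛-cong (slice-slice k l sym-f) (slice-slice (x ∸ k) (y ∸ l) sym-g) β)) ⟩
    sumBelow (suc y) (λ l → sumBelow (suc x) (λ k → (slice k (slice l f) ⊛ slice (x ∸ k) (slice (y ∸ l) g)) β))
      ≈⟨ ⊛-∷-∷ y x β f g ⟨
    (f ⊛ g) (y ∷ x ∷ β)
      ∎

  ⊛-bounded : ∀ f g {d₁ d₂} → Bounded d₁ f → Bounded d₂ g → Bounded (d₁ ℕ.+ d₂) (f ⊛ g)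
  ⊛-bounded f g {d₁} {d₂} bnd-f bnd-g α d<|α| =
    trans (convolution-cong α {G = λ _ _ → 0#} term≈0) (ΣK-map-0 (below α) (λ _ → refl))
    where
    term≈0 : ∀ β γ → sum β ℕ.+ sum γ ≡ sum α → f β * g γ ≈ 0#
    term≈0 β γ sum≡ with d₁ ℕₚ.<? sum β | d₂ ℕₚ.<? sum γ
    ... | yes d₁<|β| | _         = trans (*-cong (bnd-f β d₁<|β|) refl) (zeroˡ _)
    ... | no _       | yes d₂<|γ| = trans (*-cong refl (bnd-g γ d₂<|γ|)) (zeroʳ _)
    ... | no d₁≮|β|  | no d₂≮|γ|  = contradiction d<|α| (ℕₚ.≤⇒≯ (≡.subst (ℕ._≤ d₁ ℕ.+ d₂) sum≡
                                      (ℕₚ.+-mono-≤ (ℕₚ.≮⇒≥ d₁≮|β|) (ℕₚ.≮⇒≥ d₂≮|γ|))))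

  InΛ-⊛ : ∀ {f g} → InΛ f → InΛ g → InΛ (f ⊛ g)
  InΛ-⊛ {f} {g} f∈Λ g∈Λ = record
    { pad       = ⊛-padded f g (pad f∈Λ) (pad g∈Λ)
    ; symmetric = ⊛-symmetric f g (symmetric f∈Λ) (symmetric g∈Λ)
    ; bounded   = _ , ⊛-bounded f g (proj₂ (bounded f∈Λ)) (proj₂ (bounded g∈Λ))
    }
    where open InΛ

  InΛ-⊕ : ∀ {f g} → InΛ f → InΛ g → InΛ (f ⊕ g)
  InΛ-⊕ f∈Λ g∈Λ = record
    { pad       = λ α → +-cong (pad f∈Λ α) (pad g∈Λ α)
    ; symmetric = λ α β α↭β → +-cong (symmetric f∈Λ α β α↭β) (symmetric g∈Λ α β α↭β)
    ; bounded   = d₁ ℕ.+ d₂ , λ α d<|α| →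
        trans (+-cong (bnd-f α (ℕₚ.≤-<-trans (ℕₚ.m≤m+n d₁ d₂) d<|α|))
                      (bnd-g α (ℕₚ.≤-<-trans (ℕₚ.m≤n+m d₂ d₁) d<|α|)))
              (+-identityˡ 0#)
    }
    where
    open InΛ
    d₁ = proj₁ (bounded f∈Λ)
    d₂ = proj₁ (bounded g∈Λ)
    bnd-f = proj₂ (bounded f∈Λ)
    bnd-g = proj₂ (bounded g∈Λ)

  InΛ-· : ∀ k {f} → InΛ f → InΛ (k · f)
  InΛ-· k f∈Λ = record
    { pad       = λ α → *-cong refl (pad f∈Λ α)
    ; symmetric = λ α β α↭β → *-cong refl (symmetric f∈Λ α β α↭β)
    ; bounded   = proj₁ (bounded f∈Λ) , λ α d<|α| → trans (*-cong refl (proj₂ (bounded f∈Λ) α d<|α|)) (zeroʳ k)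
    }
    where open InΛ

  InΛ-resp-≈S : ∀ {f g} → f ≈S g → InΛ f → InΛ g
  InΛ-resp-≈S f≈g f∈Λ = record
    { pad       = λ α → trans (sym (f≈g _)) (trans (pad f∈Λ α) (f≈g α))
    ; symmetric = λ α β α↭β → trans (sym (f≈g α)) (trans (symmetric f∈Λ α β α↭β) (f≈g β))
    ; bounded   = proj₁ (bounded f∈Λ) , λ α d<|α| → trans (sym (f≈g α)) (proj₂ (bounded f∈Λ) α d<|α|)
    }
    where open InΛ

  indicator : Bool → K
  indicator b = if b then 1# else 0#

  InΛ-one : InΛ one
  InΛ-one = record
    { pad       = λ α → ≡⇒≈ (≡.cong indicator (all-++-[0] (_≡ᵇ 0) ≡.refl α))
    ; symmetric = λ α β α↭β → ≡⇒≈ (≡.cong indicator (all-↭ (_≡ᵇ 0) α↭β))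
    ; bounded   = 0 , λ α 0<|α| →
        ≡⇒≈ (≡.cong indicator (≡.trans (all≡ᵇ0≡sum≡ᵇ0 α) (n<m⇒m≡ᵇn≡false (sum α) 0 0<|α|)))
    }

  InΛ-h : ∀ r → InΛ (h r)
  InΛ-h r = record
    { pad       = λ α → ≡⇒≈ (≡.cong (λ s → indicator (s ≡ᵇ r)) (sum-++-[0] α))
    ; symmetric = λ α β α↭β → ≡⇒≈ (≡.cong (λ s → indicator (s ≡ᵇ r)) (ListActionₚ.sum-↭ α↭β))
    ; bounded   = r , λ α r<|α| → ≡⇒≈ (≡.cong indicator (n<m⇒m≡ᵇn≡false (sum α) r r<|α|))
    }

  InΛ-e : ∀ r → InΛ (e r)
  InΛ-e r = record
    { pad       = λ α → ≡⇒≈ (≡.cong₂ e-coeff (all-++-[0] (_≤ᵇ 1) ≡.refl α) (sum-++-[0] α))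
    ; symmetric = λ α β α↭β → ≡⇒≈ (≡.cong₂ e-coeff (all-↭ (_≤ᵇ 1) α↭β) (ListActionₚ.sum-↭ α↭β))
    ; bounded   = r , λ α r<|α| → ≡⇒≈ (≡.cong indicator
        (≡.trans (≡.cong (all (_≤ᵇ 1) α ∧_) (n<m⇒m≡ᵇn≡false (sum α) r r<|α|)) (Boolₚ.∧-zeroʳ _)))
    }
    where
    e-coeff : Bool → ℕ → K
    e-coeff b s = indicator (b ∧ (s ≡ᵇ r))

  zeroSeries : Series
  zeroSeries _ = 0#

  InΛ-zeroSeries : InΛ zeroSeries
  InΛ-zeroSeries = InΛ-resp-≈S (λ α → zeroˡ (one α)) (InΛ-· 0# InΛ-one)

  h0≈one : h 0 ≈S one
  h0≈one α = ≡⇒≈ (≡.cong indicator (≡.sym (all≡ᵇ0≡sum≡ᵇ0 α)))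

  e0≈one : e 0 ≈S one
  e0≈one α = ≡⇒≈ (≡.cong indicator (≡.trans (all≤ᵇ1∧sum≡ᵇ0≡sum≡ᵇ0 α) (≡.sym (all≡ᵇ0≡sum≡ᵇ0 α))))

  e0-⊛ : ∀ g → (e 0 ⊛ g) ≈S g
  e0-⊛ g = ≈S-trans (⊛-cong {g = g} e0≈one (λ _ → refl)) (one-⊛ g)

  h0-⊛ : ∀ g → (h 0 ⊛ g) ≈S g
  h0-⊛ g = ≈S-trans (⊛-cong {g = g} h0≈one (λ _ → refl)) (one-⊛ g)

  -- Coefficients of Σ_{a+b=m} w(a,b) e_a h_b

  w*0*x≈0 : ∀ w x → w * (0# * x) ≈ 0#
  w*0*x≈0 w x = trans (*-cong refl (zeroˡ x)) (zeroʳ w)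

  *-indicator-≡ᵇ : ∀ (F : ℕ → K) d n → F n * indicator (d ≡ᵇ n) ≈ guard (d ≡ᵇ n) (F d)
  *-indicator-≡ᵇ F d n with d ≡ᵇ n in eq
  ... | true  rewrite ℕₚ.≡ᵇ⇒≡ d n (≡.subst T (≡.sym eq) _) = *-identityʳ (F n)
  ... | false = zeroʳ (F n)

  antidiagonalSum-δ : ∀ m c d (w : ℕ → ℕ → K) →
    antidiagonalSum m (λ a b → w a b * (indicator (c ≡ᵇ a) * indicator (d ≡ᵇ b))) ≈ guard (c ℕ.+ d ≡ᵇ m) (w c d)
  antidiagonalSum-δ zero    zero    d w = trans (*-cong refl (*-identityˡ _)) (*-indicator-≡ᵇ (w 0) d 0)
  antidiagonalSum-δ zero    (suc c) d w = w*0*x≈0 (w 0 0) _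
  antidiagonalSum-δ (suc m) (suc c) d w =
    trans (+-cong (w*0*x≈0 (w 0 (suc m)) _) (antidiagonalSum-δ m c d (λ a → w (suc a)))) (+-identityˡ _)
  antidiagonalSum-δ (suc m) zero    d w = begin
    w 0 (suc m) * (1# * indicator (d ≡ᵇ suc m)) + antidiagonalSum m (λ a b → w (suc a) b * (0# * indicator (d ≡ᵇ b)))
      ≈⟨ +-cong (*-cong refl (*-identityˡ _)) (antidiagonalSum-0 m (λ a b → w*0*x≈0 (w (suc a) b) _)) ⟩
    w 0 (suc m) * indicator (d ≡ᵇ suc m) + 0#  ≈⟨ +-identityʳ _ ⟩
    w 0 (suc m) * indicator (d ≡ᵇ suc m)       ≈⟨ *-indicator-≡ᵇ (w 0) d (suc m) ⟩
    guard (d ≡ᵇ suc m) (w 0 d)                 ∎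

  antidiagonalSum-e-h : ∀ m β γ (w : ℕ → ℕ → K) →
    antidiagonalSum m (λ a b → w a b * (e a β * h b γ)) ≈
    guard (sum β ℕ.+ sum γ ≡ᵇ m) (guard (all (_≤ᵇ 1) β) (w (sum β) (sum γ)))
  antidiagonalSum-e-h m β γ w with all (_≤ᵇ 1) β
  ... | true  = antidiagonalSum-δ m (sum β) (sum γ) w
  ... | false = trans (antidiagonalSum-0 m (λ a b → w*0*x≈0 (w a b) _)) (sym (guard-0 _))

  antidiagonalSumS : ℕ → (ℕ → ℕ → Series) → Series
  antidiagonalSumS m F α = antidiagonalSum m (λ a b → F a b α)

  ehSum : ℕ → (ℕ → ℕ → K) → Series
  ehSum m w = antidiagonalSumS m (λ a b → w a b · (e a ⊛ h b))

  InΛ-antidiagonalSumS : ∀ m F → (∀ a b → InΛ (F a b)) → InΛ (antidiagonalSumS m F)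
  InΛ-antidiagonalSumS zero    F F∈Λ = F∈Λ 0 0
  InΛ-antidiagonalSumS (suc m) F F∈Λ = InΛ-⊕ (F∈Λ 0 (suc m)) (InΛ-antidiagonalSumS m (λ a → F (suc a)) (λ a → F∈Λ (suc a)))

  InΛ-ehSum : ∀ m w → InΛ (ehSum m w)
  InΛ-ehSum m w = InΛ-antidiagonalSumS m (λ a b → w a b · (e a ⊛ h b)) (λ a b → InΛ-· (w a b) (InΛ-⊛ (InΛ-e a) (InΛ-h b)))

  antidiagonalSumS-cong : ∀ m {F G} → (∀ a b → b ≤ m → F a b ≈S G a b) → antidiagonalSumS m F ≈S antidiagonalSumS m G
  antidiagonalSumS-cong m F≈G α = antidiagonalSum-cong m (λ a b b≤m → F≈G a b b≤m α)

  he-sum≈ehSum : ∀ m (w : ℕ → ℕ → K) → antidiagonalSumS m (λ a b → w a b · (h a ⊛ e b)) ≈S ehSum m (λ a b → w b a)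
  he-sum≈ehSum m w α = trans (antidiagonalSum-cong m (λ a b _ → *-cong refl (⊛-comm (h a) (e b) α)))
                             (antidiagonalSum-swap m (λ a b → w a b * (e b ⊛ h a) α))

  zeroOneSplit : (ℕ → ℕ → K) → Mon → Mon → K
  zeroOneSplit w β γ = guard (all (_≤ᵇ 1) β) (w (sum β) (sum γ))

  ehWeight : (ℕ → ℕ → K) → Mon → K
  ehWeight w α = convolution α (zeroOneSplit w)

  ehSum-coeff : ∀ m w α → ehSum m w α ≈ guard (sum α ≡ᵇ m) (ehWeight w α)
  ehSum-coeff m w α = begin
    antidiagonalSum m (λ a b → w a b * convolution α (λ β γ → e a β * h b γ))
      ≈⟨ antidiagonalSum-cong m (λ a b _ → *-distribˡ-ΣK-map (w a b) _ (below α)) ⟩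
    antidiagonalSum m (λ a b → convolution α (λ β γ → w a b * (e a β * h b γ)))
      ≈⟨ antidiagonalSum-ΣK-map m (λ a b β → w a b * (e a β * h b (zipWith _∸_ α β))) (below α) ⟩
    convolution α (λ β γ → antidiagonalSum m (λ a b → w a b * (e a β * h b γ)))
      ≈⟨ ΣK-map-cong (below α) (λ β → antidiagonalSum-e-h m β (zipWith _∸_ α β) w) ⟩
    convolution α (λ β γ → guard (sum β ℕ.+ sum γ ≡ᵇ m) (zeroOneSplit w β γ))
      ≈⟨ convolution-cong α (λ β γ sum≡ → ≡⇒≈ (≡.cong (λ s → guard (s ≡ᵇ m) (zeroOneSplit w β γ)) sum≡)) ⟩
    convolution α (λ β γ → guard (sum α ≡ᵇ m) (zeroOneSplit w β γ))
      ≈⟨ ΣK-map-guard (sum α ≡ᵇ m) (λ β → zeroOneSplit w β (zipWith _∸_ α β)) (below α) ⟩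
    guard (sum α ≡ᵇ m) (ehWeight w α) ∎

  ehWeight-+ : ∀ w₁ w₂ α → ehWeight (λ a b → w₁ a b + w₂ a b) α ≈ ehWeight w₁ α + ehWeight w₂ α
  ehWeight-+ w₁ w₂ α = trans (ΣK-map-cong (below α) (λ β → guard-+ (all (_≤ᵇ 1) β) _ _)) (ΣK-map-+ _ _ (below α))

  -- A nonzero part x+1 of α either lies in the h-factor (β_i = 0)
  -- or gives one of its variables to the e-factor (β_i = 1).
  ehWeightStep : ℕ → (ℕ → ℕ → K) → ℕ → ℕ → K
  ehWeightStep x w a b = w a (suc x ℕ.+ b) + w (suc a) (x ℕ.+ b)

  ehWeightRec : (ℕ → ℕ → K) → Mon → K
  ehWeightRec w []          = w 0 0
  ehWeightRec w (zero  ∷ α) = ehWeightRec w α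
  ehWeightRec w (suc x ∷ α) = ehWeightRec (ehWeightStep x w) α

  ehWeight≈ehWeightRec : ∀ α w → ehWeight w α ≈ ehWeightRec w α
  ehWeight≈ehWeightRec []          w = +-identityʳ _
  ehWeight≈ehWeightRec (zero  ∷ α) w =
    trans (convolution-∷ 0 α (zeroOneSplit w)) (trans (+-identityʳ _) (ehWeight≈ehWeightRec α w))
  ehWeight≈ehWeightRec (suc x ∷ α) w = begin
    ehWeight w (suc x ∷ α)
      ≈⟨ convolution-∷ (suc x) α (zeroOneSplit w) ⟩
    ehWeight (λ a b → w a (suc x ℕ.+ b)) α +
      (ehWeight (λ a b → w (suc a) (x ℕ.+ b)) α + sumBelow x (λ _ → ΣK (map (λ _ → 0#) (below α))))
      ≈⟨ +-cong refl (trans (+-cong refl (sumBelow-0 x (λ _ → ΣK-map-0 (below α) (λ _ → refl)))) (+-identityʳ _)) ⟩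
    ehWeight (λ a b → w a (suc x ℕ.+ b)) α + ehWeight (λ a b → w (suc a) (x ℕ.+ b)) α
      ≈⟨ ehWeight-+ (λ a b → w a (suc x ℕ.+ b)) (λ a b → w (suc a) (x ℕ.+ b)) α ⟨
    ehWeight (ehWeightStep x w) α
      ≈⟨ ehWeight≈ehWeightRec α (ehWeightStep x w) ⟩
    ehWeightRec w (suc x ∷ α) ∎

  -- Subtraction-free forms of v^ℓ u^(|α|-ℓ) and v^(ℓ-1) u^(|α|-ℓ), ℓ the number of nonzero parts of α.
  runWeight : K → K → Mon → K
  runWeight u v []          = 1#
  runWeight u v (zero  ∷ α) = runWeight u v α
  runWeight u v (suc x ∷ α) = (v * pow u x) * runWeight u v α

  leadingRunWeight : K → K → Mon → K
  leadingRunWeight u v []          = 1#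
  leadingRunWeight u v (zero  ∷ α) = leadingRunWeight u v α
  leadingRunWeight u v (suc x ∷ α) = pow u x * runWeight u v α

  module EHWeightClosedForm (u v : K) (s : ℕ → ℕ → K)
    (s-step : ∀ x a b → ehWeightStep x s a b ≈ (v * pow u x) * s a b) (s-00 : s 0 0 ≈ 1#) where

    ehWeightRec-scaled : ∀ α κ w → (∀ a b → w a b ≈ κ * s a b) → ehWeightRec w α ≈ κ * runWeight u v α
    ehWeightRec-scaled []          κ w w≈κs = trans (w≈κs 0 0) (*-cong refl s-00)
    ehWeightRec-scaled (zero  ∷ α) κ w w≈κs = ehWeightRec-scaled α κ w w≈κs
    ehWeightRec-scaled (suc x ∷ α) κ w w≈κs =
      trans (ehWeightRec-scaled α (κ * (v * pow u x)) (ehWeightStep x w) step≈) (*-assoc _ _ _)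
      where
      step≈ : ∀ a b → ehWeightStep x w a b ≈ (κ * (v * pow u x)) * s a b
      step≈ a b = begin
        w a (suc x ℕ.+ b) + w (suc a) (x ℕ.+ b)         ≈⟨ +-cong (w≈κs _ _) (w≈κs _ _) ⟩
        κ * s a (suc x ℕ.+ b) + κ * s (suc a) (x ℕ.+ b) ≈⟨ distribˡ κ _ _ ⟨
        κ * ehWeightStep x s a b                          ≈⟨ *-cong refl (s-step x a b) ⟩
        κ * ((v * pow u x) * s a b)                      ≈⟨ *-assoc _ _ _ ⟨
        (κ * (v * pow u x)) * s a b                      ∎

    ehWeightRec-leading : ∀ w → (∀ x a b → ehWeightStep x w a b ≈ pow u x * s a b) → ∀ r α →
      guard (sum α ≡ᵇ suc r) (ehWeightRec w α) ≈ guard (sum α ≡ᵇ suc r) (leadingRunWeight u v α)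
    ehWeightRec-leading w w-step r []          = refl
    ehWeightRec-leading w w-step r (zero  ∷ α) = ehWeightRec-leading w w-step r α
    ehWeightRec-leading w w-step r (suc x ∷ α) =
      guard-cong (x ℕ.+ sum α ≡ᵇ r) (ehWeightRec-scaled α (pow u x) (ehWeightStep x w) (w-step x))

    ehSum-closed : ∀ w → (∀ x a b → ehWeightStep x w a b ≈ pow u x * s a b) → ∀ r →
      ehSum (suc r) w ≈S (λ α → guard (sum α ≡ᵇ suc r) (leadingRunWeight u v α))
    ehSum-closed w w-step r α = begin
      ehSum (suc r) w α                                      ≈⟨ ehSum-coeff (suc r) w α ⟩
      guard (sum α ≡ᵇ suc r) (ehWeight w α)                  ≈⟨ guard-cong (sum α ≡ᵇ suc r) (ehWeight≈ehWeightRec α w) ⟩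
      guard (sum α ≡ᵇ suc r) (ehWeightRec w α)               ≈⟨ ehWeightRec-leading w w-step r α ⟩
      guard (sum α ≡ᵇ suc r) (leadingRunWeight u v α)        ∎

  ehWeightRec-0 : ∀ α w → (∀ a b → w a b ≈ 0#) → ehWeightRec w α ≈ 0#
  ehWeightRec-0 []          w w≈0 = w≈0 0 0
  ehWeightRec-0 (zero  ∷ α) w w≈0 = ehWeightRec-0 α w w≈0
  ehWeightRec-0 (suc x ∷ α) w w≈0 =
    ehWeightRec-0 α (ehWeightStep x w) (λ a b → trans (+-cong (w≈0 _ _) (w≈0 _ _)) (+-identityˡ 0#))

  ehWeightRec-vanishing : ∀ w → (∀ x a b → ehWeightStep x w a b ≈ 0#) → ∀ r α →
    guard (sum α ≡ᵇ suc r) (ehWeightRec w α) ≈ 0#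
  ehWeightRec-vanishing w w-step r []          = refl
  ehWeightRec-vanishing w w-step r (zero  ∷ α) = ehWeightRec-vanishing w w-step r α
  ehWeightRec-vanishing w w-step r (suc x ∷ α) =
    trans (guard-cong (x ℕ.+ sum α ≡ᵇ r) (ehWeightRec-0 α (ehWeightStep x w) (w-step x))) (guard-0 _)

  ehSum-vanishing : ∀ w → (∀ x a b → ehWeightStep x w a b ≈ 0#) → ∀ r → ehSum (suc r) w ≈S zeroSeries
  ehSum-vanishing w w-step r α =
    trans (ehSum-coeff (suc r) w α) (trans (guard-cong (sum α ≡ᵇ suc r) (ehWeight≈ehWeightRec α w))
                                           (ehWeightRec-vanishing w w-step r α))

  -- Coefficients of p̄_r and p̃_r

  matches : Mon → Mon → Bool
  matches γ α = does (≡-dec _≟_ γ α)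

  contentTerm : (List ℕ → K) → Mon → List ℕ → K
  contentTerm wt α J = guard (matches (content J (length α)) α) (wt J)

  contentTerm-≡ : ∀ wt α J {γ} → content J (length α) ≡ γ → contentTerm wt α J ≈ guard (matches γ α) (wt J)
  contentTerm-≡ wt α J eq = ≡⇒≈ (≡.cong (λ γ → guard (matches γ α) (wt J)) eq)

  coeffJ-suc : ∀ wt r y α → coeffJ wt (suc r) (y ∷ α) ≈
    ΣK (map (contentTerm wt (y ∷ α) ∘ (1 ∷_)) (wi r 1 (suc (length α)))) +
    ΣK (map (contentTerm wt (y ∷ α) ∘ map suc) (wi (suc r) 1 (length α)))
  coeffJ-suc wt r y α = begin
    ΣK (map term (wi (suc r) 1 (suc n)))
      ≡⟨ ≡.cong (ΣK ∘ map term) (wi-1-suc r n) ⟩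
    ΣK (map term (map (1 ∷_) (wi r 1 (suc n)) ++ shiftAll (wi (suc r) 1 n)))
      ≈⟨ ΣK-map-++ term (map (1 ∷_) (wi r 1 (suc n))) (shiftAll (wi (suc r) 1 n)) ⟩
    ΣK (map term (map (1 ∷_) (wi r 1 (suc n)))) + ΣK (map term (shiftAll (wi (suc r) 1 n)))
      ≡⟨ ≡.cong₂ _+_ (ΣK-map-∘ term (1 ∷_) (wi r 1 (suc n))) (ΣK-map-∘ term (map suc) (wi (suc r) 1 n)) ⟩
    ΣK (map (term ∘ (1 ∷_)) (wi r 1 (suc n))) + ΣK (map (term ∘ map suc) (wi (suc r) 1 n)) ∎
    where
    n = length α
    term = contentTerm wt (y ∷ α)

  coeffJ-0∷ : ∀ wt r α → coeffJ wt r (0 ∷ α) ≈ coeffJ (wt ∘ map suc) r α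
  coeffJ-0∷ wt zero    α = +-cong (contentTerm-≡ wt (0 ∷ α) [] (content-map-suc [] (length α) [])) refl
  coeffJ-0∷ wt (suc r) α = begin
    coeffJ wt (suc r) (0 ∷ α)
      ≈⟨ coeffJ-suc wt r 0 α ⟩
    ΣK (map (term ∘ (1 ∷_)) (wi r 1 (suc n))) + ΣK (map (term ∘ map suc) (wi (suc r) 1 n))
      ≈⟨ +-cong (ΣK-map-0 (wi r 1 (suc n)) λ J → contentTerm-≡ wt (0 ∷ α) (1 ∷ J) (content-suc (1 ∷ J) n))
                (ΣK-map-cong-All (wi-positive (suc r) n) λ J J>0 → contentTerm-≡ wt (0 ∷ α) (map suc J) (content-map-suc J n J>0)) ⟩
    0# + coeffJ (wt ∘ map suc) (suc r) α
      ≈⟨ +-identityˡ _ ⟩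
    coeffJ (wt ∘ map suc) (suc r) α ∎
    where
    n = length α
    term = contentTerm wt (0 ∷ α)

  coeffJ-suc∷ : ∀ wt r x α → coeffJ wt (suc r) (suc x ∷ α) ≈ coeffJ (wt ∘ (1 ∷_)) r (x ∷ α)
  coeffJ-suc∷ wt r x α = begin
    coeffJ wt (suc r) (suc x ∷ α)
      ≈⟨ coeffJ-suc wt r (suc x) α ⟩
    ΣK (map (term ∘ (1 ∷_)) (wi r 1 (suc n))) + ΣK (map (term ∘ map suc) (wi (suc r) 1 n))
      ≈⟨ +-cong (ΣK-map-cong (wi r 1 (suc n)) λ J → trans (contentTerm-≡ wt (suc x ∷ α) (1 ∷ J) (content-suc (1 ∷ J) n))
                                                          (sym (contentTerm-≡ (wt ∘ (1 ∷_)) (x ∷ α) J (content-suc J n))))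
                (trans (ΣK-map-cong-All (wi-positive (suc r) n) λ J J>0 →
                          contentTerm-≡ wt (suc x ∷ α) (map suc J) (content-map-suc J n J>0))
                       (ΣK-map-0 (wi (suc r) 1 n) (λ _ → refl))) ⟩
    coeffJ (wt ∘ (1 ∷_)) r (x ∷ α) + 0#
      ≈⟨ +-identityʳ _ ⟩
    coeffJ (wt ∘ (1 ∷_)) r (x ∷ α) ∎
    where
    n = length α
    term = contentTerm wt (suc x ∷ α)

  coeffJ-0-suc∷ : ∀ wt x α → coeffJ wt 0 (suc x ∷ α) ≈ 0#
  coeffJ-0-suc∷ wt x α = trans (+-cong (contentTerm-≡ wt (suc x ∷ α) [] (content-map-suc [] (length α) [])) refl) (+-identityˡ 0#)

  -- map suc (seqOfContent₀ α) is the weakly increasing sequence of content α; the shifted form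
  -- makes both recursion steps of coeffJ definitional.
  seqOfContent₀ : Mon → List ℕ
  seqOfContent₀ []      = []
  seqOfContent₀ (x ∷ α) = replicate x 0 ++ map suc (seqOfContent₀ α)

  coeffJ≈seqOfContent : ∀ wt r α → coeffJ wt r α ≈ guard (sum α ≡ᵇ r) (wt (map suc (seqOfContent₀ α)))
  coeffJ≈seqOfContent wt zero    []          = +-identityʳ _
  coeffJ≈seqOfContent wt (suc r) []          = refl
  coeffJ≈seqOfContent wt r       (zero  ∷ α) = trans (coeffJ-0∷ wt r α) (coeffJ≈seqOfContent (wt ∘ map suc) r α)
  coeffJ≈seqOfContent wt zero    (suc x ∷ α) = coeffJ-0-suc∷ wt x α
  coeffJ≈seqOfContent wt (suc r) (suc x ∷ α) = trans (coeffJ-suc∷ wt r x α) (coeffJ≈seqOfContent (wt ∘ (1 ∷_)) r (x ∷ α))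

  N=-map-suc : ∀ J → N= (map suc J) ≡ N= J
  N=-map-suc []          = ≡.refl
  N=-map-suc (_ ∷ [])    = ≡.refl
  N=-map-suc (a ∷ b ∷ J) = ≡.cong ((if a ≡ᵇ b then 1 else 0) ℕ.+_) (N=-map-suc (b ∷ J))

  N<-map-suc : ∀ J → N< (map suc J) ≡ N< J
  N<-map-suc []          = ≡.refl
  N<-map-suc (_ ∷ [])    = ≡.refl
  N<-map-suc (a ∷ b ∷ J) = ≡.cong ((if a <ᵇ b then 1 else 0) ℕ.+_) (N<-map-suc (b ∷ J))

  pairWeight : K → K → List ℕ → K
  pairWeight u v J = pow u (N= J) * pow v (N< J)

  module _ (u v : K) where
    private
      W = pairWeight u v

    pairWeight-map-suc : ∀ J → W (map suc J) ≡ W J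
    pairWeight-map-suc J = ≡.cong₂ (λ m n → pow u m * pow v n) (N=-map-suc J) (N<-map-suc J)

    pairWeight-0∷0∷ : ∀ J → W (0 ∷ 0 ∷ J) ≈ u * W (0 ∷ J)
    pairWeight-0∷0∷ J = *-assoc u _ _

    pairWeight-0∷suc∷ : ∀ b J → W (0 ∷ suc b ∷ J) ≈ v * W (suc b ∷ J)
    pairWeight-0∷suc∷ b J = *-Comm.x∙yz≈y∙xz _ v _

    pairWeight-0∷replicate : ∀ x J → W (0 ∷ replicate x 0 ++ J) ≈ pow u x * W (0 ∷ J)
    pairWeight-0∷replicate zero    J = sym (*-identityˡ _)
    pairWeight-0∷replicate (suc x) J = begin
      W (0 ∷ 0 ∷ replicate x 0 ++ J)  ≈⟨ pairWeight-0∷0∷ (replicate x 0 ++ J) ⟩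
      u * W (0 ∷ replicate x 0 ++ J)  ≈⟨ *-cong refl (pairWeight-0∷replicate x J) ⟩
      u * (pow u x * W (0 ∷ J))       ≈⟨ *-assoc _ _ _ ⟨
      pow u (suc x) * W (0 ∷ J)       ∎

    pairWeight-0∷map-suc² : ∀ J → W (0 ∷ map suc (map suc J)) ≡ W (0 ∷ map suc J)
    pairWeight-0∷map-suc² []      = ≡.refl
    pairWeight-0∷map-suc² (j ∷ J) =
      ≡.cong₂ (λ m n → pow u m * pow v (suc n)) (N=-map-suc (suc j ∷ map suc J)) (N<-map-suc (suc j ∷ map suc J))

    pairWeight-0∷seqOfContent₀ : ∀ α → W (0 ∷ map suc (seqOfContent₀ α)) ≈ runWeight u v α
    pairWeight-0∷seqOfContent₀ []          = *-identityˡ _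
    pairWeight-0∷seqOfContent₀ (zero  ∷ α) =
      trans (≡⇒≈ (pairWeight-0∷map-suc² (seqOfContent₀ α))) (pairWeight-0∷seqOfContent₀ α)
    pairWeight-0∷seqOfContent₀ (suc x ∷ α) = begin
      W (0 ∷ 1 ∷ map suc (replicate x 0 ++ S))   ≈⟨ pairWeight-0∷suc∷ 0 (map suc (replicate x 0 ++ S)) ⟩
      v * W (map suc (0 ∷ replicate x 0 ++ S))   ≡⟨ ≡.cong (v *_) (pairWeight-map-suc (0 ∷ replicate x 0 ++ S)) ⟩
      v * W (0 ∷ replicate x 0 ++ S)             ≈⟨ *-cong refl (pairWeight-0∷replicate x S) ⟩
      v * (pow u x * W (0 ∷ S))                  ≈⟨ *-cong refl (*-cong refl (pairWeight-0∷seqOfContent₀ α)) ⟩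
      v * (pow u x * runWeight u v α)            ≈⟨ *-assoc _ _ _ ⟨
      (v * pow u x) * runWeight u v α            ∎
      where S = map suc (seqOfContent₀ α)

    pairWeight-seqOfContent₀ : ∀ α → W (seqOfContent₀ α) ≈ leadingRunWeight u v α
    pairWeight-seqOfContent₀ []          = *-identityˡ _
    pairWeight-seqOfContent₀ (zero  ∷ α) =
      trans (≡⇒≈ (pairWeight-map-suc (seqOfContent₀ α))) (pairWeight-seqOfContent₀ α)
    pairWeight-seqOfContent₀ (suc x ∷ α) =
      trans (pairWeight-0∷replicate x (map suc (seqOfContent₀ α))) (*-cong refl (pairWeight-0∷seqOfContent₀ α))

    coeffJ-pairWeight : ∀ r α → coeffJ W r α ≈ guard (sum α ≡ᵇ r) (leadingRunWeight u v α)
    coeffJ-pairWeight r α = trans (coeffJ≈seqOfContent W r α) (guard-cong (sum α ≡ᵇ r)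
      (trans (≡⇒≈ (pairWeight-map-suc (seqOfContent₀ α))) (pairWeight-seqOfContent₀ α)))


  open import Algebra.Properties.Ring ring using (-1*x≈-x; +-cancelʳ)

  p*[y+z]+-1*p*y≈p*z : ∀ p y z → p * (y + z) + (- 1# * p) * y ≈ p * z
  p*[y+z]+-1*p*y≈p*z p y z = begin
    p * (y + z) + (- 1# * p) * y  ≈⟨ +-cong (distribˡ p y z) (trans (*-assoc _ _ _) (-1*x≈-x _)) ⟩
    (p * y + p * z) + - (p * y)   ≈⟨ +-cong (+-comm _ _) refl ⟩
    (p * z + p * y) + - (p * y)   ≈⟨ +-assoc _ _ _ ⟩
    p * z + (p * y + - (p * y))   ≈⟨ +-cong refl (-‿inverseʳ _) ⟩
    p * z + 0#                    ≈⟨ +-identityʳ _ ⟩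
    p * z                         ∎

  p+-1*p≈0 : ∀ p → p + - 1# * p ≈ 0#
  p+-1*p≈0 p = trans (+-cong refl (-1*x≈-x p)) (-‿inverseʳ p)

  alternatingˡ alternatingʳ : ℕ → ℕ → K
  alternatingˡ a b = pow (- 1#) a
  alternatingʳ a b = pow (- 1#) b

  alternatingˡ-step : ∀ x a b → ehWeightStep x alternatingˡ a b ≈ 0#
  alternatingˡ-step x a b = p+-1*p≈0 _

  alternatingʳ-step : ∀ x a b → ehWeightStep x alternatingʳ a b ≈ 0#
  alternatingʳ-step x a b = trans (+-comm _ _) (p+-1*p≈0 _)

  module QWeights (q : K) where

    [_]q : ℕ → K
    [ zero  ]q = 0#
    [ suc n ]q = [ n ]q + pow q n

    wbar wtilde sbar stilde : ℕ → ℕ → K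
    wbar   a b = pow (- 1#) a * [ b ]q
    wtilde a b = pow (- 1#) b * [ a ]q
    sbar   a b = pow (- 1#) a * pow q b
    stilde a b = pow (- 1#) b * pow q a

    wbar-step : ∀ x a b → ehWeightStep x wbar a b ≈ pow q x * sbar a b
    wbar-step x a b = begin
      pow (- 1#) a * ([ x ℕ.+ b ]q + pow q (x ℕ.+ b)) + (- 1# * pow (- 1#) a) * [ x ℕ.+ b ]q
        ≈⟨ p*[y+z]+-1*p*y≈p*z _ _ _ ⟩
      pow (- 1#) a * pow q (x ℕ.+ b)         ≈⟨ *-cong refl (pow-homo-+ q x b) ⟩
      pow (- 1#) a * (pow q x * pow q b)     ≈⟨ *-Comm.x∙yz≈y∙xz _ _ _ ⟩
      pow q x * sbar a b                     ∎

    sbar-step : ∀ x a b → ehWeightStep x sbar a b ≈ ((q - 1#) * pow q x) * sbar a b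
    sbar-step x a b = begin
      pow (- 1#) a * (q * pow q (x ℕ.+ b)) + (- 1# * pow (- 1#) a) * pow q (x ℕ.+ b)
        ≈⟨ +-cong (*-cong refl (*-cong refl (pow-homo-+ q x b))) (*-cong refl (pow-homo-+ q x b)) ⟩
      pow (- 1#) a * (q * (pow q x * pow q b)) + (- 1# * pow (- 1#) a) * (pow q x * pow q b)
        ≈⟨ solve 5 (λ P q X B m → (P :* (q :* (X :* B)) :+ (m :* P) :* (X :* B)) := (((q :+ m) :* X) :* (P :* B)))
                 refl (pow (- 1#) a) q (pow q x) (pow q b) (- 1#) ⟩
      ((q - 1#) * pow q x) * sbar a b
        ∎

    wtilde-step : ∀ x a b → ehWeightStep x wtilde a b ≈ pow (- 1#) x * stilde a b
    wtilde-step x a b = begin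
      (- 1# * pow (- 1#) (x ℕ.+ b)) * [ a ]q + pow (- 1#) (x ℕ.+ b) * ([ a ]q + pow q a)
        ≈⟨ +-comm _ _ ⟩
      pow (- 1#) (x ℕ.+ b) * ([ a ]q + pow q a) + (- 1# * pow (- 1#) (x ℕ.+ b)) * [ a ]q
        ≈⟨ p*[y+z]+-1*p*y≈p*z _ _ _ ⟩
      pow (- 1#) (x ℕ.+ b) * pow q a          ≈⟨ *-cong (pow-homo-+ (- 1#) x b) refl ⟩
      (pow (- 1#) x * pow (- 1#) b) * pow q a ≈⟨ *-assoc _ _ _ ⟩
      pow (- 1#) x * stilde a b               ∎

    stilde-step : ∀ x a b → ehWeightStep x stilde a b ≈ ((q - 1#) * pow (- 1#) x) * stilde a b
    stilde-step x a b = begin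
      (- 1# * pow (- 1#) (x ℕ.+ b)) * pow q a + pow (- 1#) (x ℕ.+ b) * (q * pow q a)
        ≈⟨ +-cong (*-cong (*-cong refl (pow-homo-+ (- 1#) x b)) refl) (*-cong (pow-homo-+ (- 1#) x b) refl) ⟩
      (- 1# * (pow (- 1#) x * pow (- 1#) b)) * pow q a + (pow (- 1#) x * pow (- 1#) b) * (q * pow q a)
        ≈⟨ solve 5 (λ m X B A q → ((m :* (X :* B)) :* A :+ (X :* B) :* (q :* A)) := (((q :+ m) :* X) :* (B :* A)))
                 refl (- 1#) (pow (- 1#) x) (pow (- 1#) b) (pow q a) q ⟩
      ((q - 1#) * pow (- 1#) x) * stilde a b
        ∎

    module Bar   = EHWeightClosedForm q        (q - 1#) sbar   sbar-step   (*-identityˡ 1#)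
    module Tilde = EHWeightClosedForm (- 1#)   (q - 1#) stilde stilde-step (*-identityˡ 1#)

    pbar₁≈ehSum : ∀ r → pbar₁ q (suc r) ≈S ehSum (suc r) wbar
    pbar₁≈ehSum r α = trans (coeffJ-pairWeight q (q - 1#) (suc r) α) (sym (Bar.ehSum-closed wbar wbar-step r α))

    ptilde₁≈ehSum : ∀ r → ptilde₁ q (suc r) ≈S ehSum (suc r) wtilde
    ptilde₁≈ehSum r α = trans (coeffJ-pairWeight (- 1#) (q - 1#) (suc r) α) (sym (Tilde.ehSum-closed wtilde wtilde-step r α))

  -- The endomorphism ω

  alternatingTail : (ℕ → Series) → (ℕ → Series) → ℕ → Series
  alternatingTail f g b = antidiagonalSumS b (λ a c → pow (- 1#) (suc a) · (f (suc a) ⊛ g c))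

  -- Σ_{a+c=b+1} (-1)^a e_a h_c = 0 and Σ_{a+c=b+1} (-1)^a h_a e_c = 0 with the term a = 0 split off.
  h+alternatingTail≈0 : ∀ b → (h (suc b) ⊕ alternatingTail e h b) ≈S zeroSeries
  h+alternatingTail≈0 b α = trans (+-cong (sym (trans (*-identityˡ _) (e0-⊛ (h (suc b)) α))) refl)
                                  (ehSum-vanishing alternatingˡ alternatingˡ-step b α)

  e+alternatingTail≈0 : ∀ b → (e (suc b) ⊕ alternatingTail h e b) ≈S zeroSeries
  e+alternatingTail≈0 b α = trans (+-cong (sym (trans (*-identityˡ _) (h0-⊛ (e (suc b)) α))) refl)
                                  (trans (he-sum≈ehSum (suc b) alternatingˡ α) (ehSum-vanishing alternatingʳ alternatingʳ-step b α))

  module _ (ω : Series → Series) (ω-endo : IsAlgEndo ω) where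
    open IsAlgEndo ω-endo

    ω-zero : ω zeroSeries ≈S zeroSeries
    ω-zero = ≈S-trans (cong _ _ InΛ-zeroSeries (InΛ-· 0# InΛ-one) (λ α → sym (zeroˡ _)))
                      (≈S-trans (hom-· 0# one InΛ-one) (λ _ → zeroˡ _))

    ω-·-⊛ : ∀ k {f g} → InΛ f → InΛ g → ω (k · (f ⊛ g)) ≈S (k · (ω f ⊛ ω g))
    ω-·-⊛ k f∈Λ g∈Λ α = trans (hom-· k _ (InΛ-⊛ f∈Λ g∈Λ) α) (*-cong refl (hom-* _ _ f∈Λ g∈Λ α))

    ω-antidiagonalSumS : ∀ m (c : ℕ → ℕ → K) (f g : ℕ → ℕ → Series) →
      (∀ a b → InΛ (f a b)) → (∀ a b → InΛ (g a b)) →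
      ω (antidiagonalSumS m (λ a b → c a b · (f a b ⊛ g a b))) ≈S antidiagonalSumS m (λ a b → c a b · (ω (f a b) ⊛ ω (g a b)))
    ω-antidiagonalSumS zero    c f g f∈Λ g∈Λ = ω-·-⊛ (c 0 0) (f∈Λ 0 0) (g∈Λ 0 0)
    ω-antidiagonalSumS (suc m) c f g f∈Λ g∈Λ α = trans
      (hom-+ _ _ (term∈Λ 0 (suc m)) (InΛ-antidiagonalSumS m _ (λ a → term∈Λ (suc a))) α)
      (+-cong (ω-·-⊛ (c 0 (suc m)) (f∈Λ 0 (suc m)) (g∈Λ 0 (suc m)) α)
              (ω-antidiagonalSumS m (λ a → c (suc a)) (λ a → f (suc a)) (λ a → g (suc a))
                                    (λ a → f∈Λ (suc a)) (λ a → g∈Λ (suc a)) α))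
      where term∈Λ = λ a b → InΛ-· (c a b) (InΛ-⊛ (f∈Λ a b) (g∈Λ a b))

    module _ (ω-e : ∀ r → ω (e r) ≈S h r) where

      ω-h : ∀ b → ω (h b) ≈S e b
      ω-h = <-rec (λ b → ω (h b) ≈S e b) step
        where
        step : ∀ b → (∀ {c} → c < b → ω (h c) ≈S e c) → ω (h b) ≈S e b
        step zero    _  = ≈S-trans (cong _ _ (InΛ-h 0) InΛ-one h0≈one) (≈S-trans hom-1 (≈S-sym e0≈one))
        -- apply ω to h+alternatingTail≈0 and compare with e+alternatingTail≈0
        step (suc b) ih α = +-cancelʳ (Y α) (ω (h (suc b)) α) (e (suc b) α) (begin
          ω (h (suc b)) α + Y α    ≈⟨ +-cong refl (ωX≈Y α) ⟨
          ω (h (suc b)) α + ω X α  ≈⟨ hom-+ _ _ (InΛ-h (suc b)) X∈Λ α ⟨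
          ω (h (suc b) ⊕ X) α      ≈⟨ cong _ _ (InΛ-⊕ (InΛ-h (suc b)) X∈Λ) InΛ-zeroSeries (h+alternatingTail≈0 b) α ⟩
          ω zeroSeries α           ≈⟨ ω-zero α ⟩
          0#                       ≈⟨ e+alternatingTail≈0 b α ⟨
          e (suc b) α + Y α        ∎)
          where
          X = alternatingTail e h b
          Y = alternatingTail h e b
          X∈Λ : InΛ X
          X∈Λ = InΛ-antidiagonalSumS b _ (λ a c → InΛ-· _ (InΛ-⊛ (InΛ-e (suc a)) (InΛ-h c)))
          ωX≈Y : ω X ≈S Y
          ωX≈Y = ≈S-trans (ω-antidiagonalSumS b _ _ _ (λ a c → InΛ-e (suc a)) (λ a c → InΛ-h c))
                          (antidiagonalSumS-cong b (λ a c c≤b β → *-cong refl (⊛-cong (ω-e (suc a)) (ih (s≤s c≤b)) β)))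

      ω-ehSum : ∀ m w → ω (ehSum m w) ≈S ehSum m (λ a b → w b a)
      ω-ehSum m w = ≈S-trans (ω-antidiagonalSumS m w (λ a _ → e a) (λ _ b → h b) (λ a _ → InΛ-e a) (λ _ b → InΛ-h b))
                    (≈S-trans (antidiagonalSumS-cong m (λ a b _ α → *-cong refl (⊛-cong (ω-e a) (ω-h b) α)))
                              (he-sum≈ehSum m w))

      module _ (q : K) where
        open QWeights q

        InΛ-pbar₁ : ∀ r → InΛ (pbar₁ q (suc r))
        InΛ-pbar₁ r = InΛ-resp-≈S (≈S-sym (pbar₁≈ehSum r)) (InΛ-ehSum (suc r) wbar)

        ω-pbar₁ : ∀ r → ω (pbar₁ q (suc r)) ≈S ptilde₁ q (suc r)
        ω-pbar₁ r = ≈S-trans (cong _ _ (InΛ-pbar₁ r) (InΛ-ehSum (suc r) wbar) (pbar₁≈ehSum r))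
                   (≈S-trans (ω-ehSum (suc r) wbar) (≈S-sym (ptilde₁≈ehSum r)))

        InΛ-pbar : ∀ μ → IsComposition μ → InΛ (pbar q μ)
        InΛ-pbar []      []       = InΛ-one
        InΛ-pbar (suc r ∷ μ) (_ ∷ μ-comp) = InΛ-⊛ (InΛ-pbar₁ r) (InΛ-pbar μ μ-comp)

        ω-pbar : ∀ μ → IsComposition μ → ω (pbar q μ) ≈S ptilde q μ
        ω-pbar []          []       = hom-1
        ω-pbar (suc r ∷ μ) (_ ∷ μ-comp) =
          ≈S-trans (hom-* _ _ (InΛ-pbar₁ r) (InΛ-pbar μ μ-comp)) (⊛-cong (ω-pbar₁ r) (ω-pbar μ μ-comp))

corollary3p5 : ∀ {c ℓ} (R : CommutativeRing c ℓ) (q : CommutativeRing.Carrier R)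
    (ω : SymFun.Series R → SymFun.Series R) →
    SymFun.IsAlgEndo R ω →
    (∀ r → SymFun._≈S_ R (ω (SymFun.e R r)) (SymFun.h R r)) →
    ∀ (μ : List ℕ) → IsComposition μ →
    SymFun._≈S_ R (ω (SymFun.pbar R q μ)) (SymFun.ptilde R q μ)
corollary3p5 R q ω ω-endo ω-e = ω-pbar R ω ω-endo ω-e q
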